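{- For all formulas $A,B$: if $A\vee B\in\mathbf{L}_{\min}$ then $A\in\mathbf{L}_{\min}$ or $B\in\mathbf{L}_{\min}$; if $A\vee B\in\mathbf{L}_{\mathbf{fc}}$ then $A\in\mathbf{L}_{\mathbf{fc}}$ or $B\in\mathbf{L}_{\mathbf{fc}}$; if $A\vee B\in\mathbf{L}_{\mathbf{bc}}$ then $A\in\mathbf{L}_{\mathbf{bc}}$ or $B\in\mathbf{L}_{\mathbf{bc}}$; if $A\vee B\in\mathbf{L}_{\mathbf{fbc}}$ then $A\in\mathbf{L}_{\mathbf{fbc}}$ or $B\in\mathbf{L}_{\mathbf{fbc}}$.
   Context: Formulas are built from a countably infinite set of atoms by $A::=p\mid (A\rightarrow A)\mid\top\mid\bot\mid(A\vee A)\mid(A\wedge A)\mid\square A\mid\lozenge A$; $\neg A$ abbreviates $A\rightarrow\bot$. An intuitionistic modal logic is a set of formulas closed under uniform substitution, containing the axioms of intuitionistic propositional logic, closed under modus ponens, containing (A1) $\square(p\rightarrow q)\rightarrow(\square p\rightarrow\square q)$, (A2) $\square(p\vee q)\rightarrow((\lozenge p\rightarrow\square q)\rightarrow\square q)$, (A3) $\lozenge(p\vee q)\rightarrow\lozenge p\vee\lozenge q$, (A4) $\neg\lozenge\bot$, and closed under (R1) from $p$ infer $\square p$, (R2) from $p\rightarrow q$ infer $\lozenge p\rightarrow\lozenge q$, (R3) from $\lozenge p\rightarrow q\vee\square(p\rightarrow r)$ infer $\lozenge p\rightarrow q\vee\lozenge r$. $\mathbf{L}_{\min}$ is the least one; $\mathbf{L}\oplus\Sigma$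 the least one containing $\mathbf{L}$ and $\Sigma$. $\mathbf{L}_{\mathbf{fc}}=\mathbf{L}_{\min}\oplus(\lozenge(p\rightarrow q)\rightarrow(\square p\rightarrow\lozenge q))$, $\mathbf{L}_{\mathbf{bc}}=\mathbf{L}_{\min}\oplus((\lozenge p\rightarrow\square q)\rightarrow\square(p\rightarrow q))$, $\mathbf{L}_{\mathbf{fbc}}=\mathbf{L}_{\min}\oplus\{\lozenge(p\rightarrow q)\rightarrow(\square p\rightarrow\lozenge q),\ (\lozenge p\rightarrow\square q)\rightarrow\square(p\rightarrow q)\}$. -}

module Defs where

open import Data.Nat using (ℕ)

data Fm : Set where
  atom : ℕ → Fm
  _⇒_  : Fm → Fm → Fm
  ⊤'   : Fm
  ⊥'   : Fm
  _∨'_ : Fm → Fm → Fm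
  _∧'_ : Fm → Fm → Fm
  □_   : Fm → Fm
  ◇_   : Fm → Fm

infixr 5 _⇒_
infixr 6 _∨'_
infixr 7 _∧'_
infix 8 □_ ◇_

¬' : Fm → Fm
¬' A = A ⇒ ⊥'

Subst : Set
Subst = ℕ → Fm

sub : Subst → Fm → Fm
sub σ (atom n) = σ n
sub σ (A ⇒ B)  = sub σ A ⇒ sub σ B
sub σ ⊤'       = ⊤'
sub σ ⊥'       = ⊥'
sub σ (A ∨' B) = sub σ A ∨' sub σ B
sub σ (A ∧' B) = sub σ A ∧' sub σ B
sub σ (□ A)    = □ sub σ A
sub σ (◇ A)    = ◇ sub σ A

p q r : Fm
p = atom 0
q = atom 1
r = atom 2

-- Axioms of intuitionistic propositional logic (standard Hilbert system,
-- stated over atoms; closure under substitution yields all instances)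
data IPCAx : Fm → Set where
  k    : IPCAx (p ⇒ q ⇒ p)
  s    : IPCAx ((p ⇒ q ⇒ r) ⇒ (p ⇒ q) ⇒ p ⇒ r)
  ∧e₁  : IPCAx (p ∧' q ⇒ p)
  ∧e₂  : IPCAx (p ∧' q ⇒ q)
  ∧i   : IPCAx (p ⇒ q ⇒ p ∧' q)
  ∨i₁  : IPCAx (p ⇒ p ∨' q)
  ∨i₂  : IPCAx (q ⇒ p ∨' q)
  ∨e   : IPCAx ((p ⇒ r) ⇒ (q ⇒ r) ⇒ p ∨' q ⇒ r)
  ⊥e   : IPCAx (⊥' ⇒ p)
  ⊤i   : IPCAx ⊤'

data ModAx : Fm → Set where
  A1 : ModAx (□ (p ⇒ q) ⇒ □ p ⇒ □ q)
  A2 : ModAx (□ (p ∨' q) ⇒ (◇ p ⇒ □ q) ⇒ □ q)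
  A3 : ModAx (◇ (p ∨' q) ⇒ ◇ p ∨' ◇ q)
  A4 : ModAx (¬' (◇ ⊥'))

data Thm (Σ' : Fm → Set) : Fm → Set where
  ipc   : ∀ {A} → IPCAx A → Thm Σ' A
  modal : ∀ {A} → ModAx A → Thm Σ' A
  extra : ∀ {A} → Σ' A → Thm Σ' A
  usub  : ∀ {A} (σ : Subst) → Thm Σ' A → Thm Σ' (sub σ A)
  mp    : ∀ {A B} → Thm Σ' (A ⇒ B) → Thm Σ' A → Thm Σ' B
  R1    : ∀ {A} → Thm Σ' A → Thm Σ' (□ A)
  R2    : ∀ {A B} → Thm Σ' (A ⇒ B) → Thm Σ' (◇ A ⇒ ◇ B)
  R3    : ∀ {A B C} → Thm Σ' (◇ A ⇒ B ∨' □ (A ⇒ C)) → Thm Σ' (◇ A ⇒ B ∨' ◇ C)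

fc bc : Fm
fc = ◇ (p ⇒ q) ⇒ □ p ⇒ ◇ q
bc = (◇ p ⇒ □ q) ⇒ □ (p ⇒ q)

data NoAx : Fm → Set where

data FcAx : Fm → Set where
  fcAx : FcAx fc

data BcAx : Fm → Set where
  bcAx : BcAx bc

data FbcAx : Fm → Set where
  fcAx : FbcAx fc
  bcAx : FbcAx bc

_∈Lmin _∈Lfc _∈Lbc _∈Lfbc : Fm → Set
A ∈Lmin = Thm NoAx A
A ∈Lfc  = Thm FcAx A
A ∈Lbc  = Thm BcAx A
A ∈Lfbc = Thm FbcAx A

module Submission where

-- An Aczel slash: A formula is slashed when it is provable and, read
-- hereditarily through ∧, ∨, ⇒, is "true", where □ A counts as true iff
-- ⊢ □ A and ◇ A is never true.  Then an implication with a ◇-antecedent or a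
-- □-consequent is slashed as soon as it is provable; every modal axiom, every
-- conclusion of R2 and R3, and every instance of fc and bc has one of these
-- two shapes, so all theorems are slashed, and a slashed disjunction has a
-- slashed, hence provable, disjunct.

open import Defs
open import Data.Product using (_×_; _,_; proj₁; proj₂)
open import Data.Sum using (_⊎_; inj₁; inj₂; [_,_])
open import Data.Nat using (zero; suc)
open import Data.Unit using (tt) renaming (⊤ to Unit)
open import Data.Empty using () renaming (⊥ to Empty)
open import Function using (_∘_)
open import Relation.Binary.PropositionalEquality using (_≡_; refl; cong; cong₂; subst; sym)

sub-∘ : ∀ σ τ A → sub σ (sub τ A) ≡ sub (sub σ ∘ τ) A
sub-∘ σ τ (atom n) = refl
sub-∘ σ τ (A ⇒ B)  = cong₂ _⇒_ (sub-∘ σ τ A) (sub-∘ σ τ B)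
sub-∘ σ τ ⊤'       = refl
sub-∘ σ τ ⊥'       = refl
sub-∘ σ τ (A ∨' B) = cong₂ _∨'_ (sub-∘ σ τ A) (sub-∘ σ τ B)
sub-∘ σ τ (A ∧' B) = cong₂ _∧'_ (sub-∘ σ τ A) (sub-∘ σ τ B)
sub-∘ σ τ (□ A)    = cong □_ (sub-∘ σ τ A)
sub-∘ σ τ (◇ A)    = cong ◇_ (sub-∘ σ τ A)

sub-id : ∀ A → sub atom A ≡ A
sub-id (atom n) = refl
sub-id (A ⇒ B)  = cong₂ _⇒_ (sub-id A) (sub-id B)
sub-id ⊤'       = refl
sub-id ⊥'       = refl
sub-id (A ∨' B) = cong₂ _∨'_ (sub-id A) (sub-id B)
sub-id (A ∧' B) = cong₂ _∧'_ (sub-id A) (sub-id B)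
sub-id (□ A)    = cong □_ (sub-id A)
sub-id (◇ A)    = cong ◇_ (sub-id A)

substPQ : Fm → Fm → Subst
substPQ A B zero    = A
substPQ A B (suc _) = B

module AczelSlash (Σ' : Fm → Set) where

  infix 3 ⊢_
  ⊢_ : Fm → Set
  ⊢_ = Thm Σ'

  Slash : Fm → Set
  Slash (atom n) = ⊢ atom n
  Slash (A ⇒ B)  = (⊢ A ⇒ B) × (Slash A → Slash B)
  Slash ⊤'       = Unit
  Slash ⊥'       = Empty
  Slash (A ∨' B) = Slash A ⊎ Slash B
  Slash (A ∧' B) = Slash A × Slash B
  Slash (□ A)    = ⊢ □ A
  Slash (◇ A)    = Empty

  slash⇒thm : ∀ {A} → Slash A → ⊢ A
  slash⇒thm {atom n} a        = a
  slash⇒thm {A ⇒ B} (d , _)   = d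
  slash⇒thm {⊤'} _            = ipc ⊤i
  slash⇒thm {A ∨' B} (inj₁ a) = mp (usub (substPQ A B) (ipc ∨i₁)) (slash⇒thm a)
  slash⇒thm {A ∨' B} (inj₂ b) = mp (usub (substPQ A B) (ipc ∨i₂)) (slash⇒thm b)
  slash⇒thm {A ∧' B} (a , b)  = mp (mp (usub (substPQ A B) (ipc ∧i)) (slash⇒thm a)) (slash⇒thm b)
  slash⇒thm {□ A} d           = d

  mp-slash : ∀ {A B} → ⊢ A ⇒ B → Slash A → ⊢ B
  mp-slash d a = mp d (slash⇒thm a)

  ◇⇒-slash : ∀ {A B} → ⊢ ◇ A ⇒ B → Slash (◇ A ⇒ B)
  ◇⇒-slash d = d , λ ()

  ⇒□-slash : ∀ {A B} → ⊢ A ⇒ □ B → Slash (A ⇒ □ B)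
  ⇒□-slash d = d , mp-slash d

  ipcAx-slash : ∀ {A} → IPCAx A → ∀ σ → Slash (sub σ A)
  ipcAx-slash k   σ = d , λ x → mp-slash d x , λ _ → x
    where d = usub σ (ipc k)
  ipcAx-slash s   σ = d , λ f → mp-slash d f , λ g → mp-slash (mp-slash d f) g ,
                        λ x → proj₂ (proj₂ f x) (proj₂ g x)
    where d = usub σ (ipc s)
  ipcAx-slash ∧e₁ σ = usub σ (ipc ∧e₁) , proj₁
  ipcAx-slash ∧e₂ σ = usub σ (ipc ∧e₂) , proj₂
  ipcAx-slash ∧i  σ = d , λ x → mp-slash d x , λ y → x , y
    where d = usub σ (ipc ∧i)
  ipcAx-slash ∨i₁ σ = usub σ (ipc ∨i₁) , inj₁
  ipcAx-slash ∨i₂ σ = usub σ (ipc ∨i₂) , inj₂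
  ipcAx-slash ∨e  σ = d , λ f → mp-slash d f , λ g → mp-slash (mp-slash d f) g ,
                        [ proj₂ f , proj₂ g ]
    where d = usub σ (ipc ∨e)
  ipcAx-slash ⊥e  σ = usub σ (ipc ⊥e) , λ ()
  ipcAx-slash ⊤i  σ = tt

  modAx-slash : ∀ {A} → ModAx A → ∀ σ → Slash (sub σ A)
  modAx-slash A1 σ = d , ⇒□-slash ∘ mp d
    where d = usub σ (modal A1)
  modAx-slash A2 σ = d , ⇒□-slash ∘ mp d
    where d = usub σ (modal A2)
  modAx-slash A3 σ = ◇⇒-slash (usub σ (modal A3))
  modAx-slash A4 σ = ◇⇒-slash (usub σ (modal A4))

  SlashClosed : Set
  SlashClosed = ∀ {A} σ → Σ' A → Slash (sub σ A)

  -- Quantifying over σ is what lets the usub case go through.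
  thm⇒slash : SlashClosed → ∀ {A} → ⊢ A → ∀ σ → Slash (sub σ A)
  thm⇒slash closed (ipc ax)       σ = ipcAx-slash ax σ
  thm⇒slash closed (modal ax)     σ = modAx-slash ax σ
  thm⇒slash closed (extra ax)     σ = closed σ ax
  thm⇒slash closed (usub {A} τ d) σ =
    subst Slash (sym (sub-∘ σ τ A)) (thm⇒slash closed d (sub σ ∘ τ))
  thm⇒slash closed (mp d e)       σ = proj₂ (thm⇒slash closed d σ) (thm⇒slash closed e σ)
  thm⇒slash closed (R1 d)         σ = usub σ (R1 d)
  thm⇒slash closed (R2 d)         σ = ◇⇒-slash (usub σ (R2 d))
  thm⇒slash closed (R3 d)         σ = ◇⇒-slash (usub σ (R3 d))

  disjunctionProperty : SlashClosed → ∀ A B → ⊢ A ∨' B → ⊢ A ⊎ ⊢ B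
  disjunctionProperty closed A B d with thm⇒slash closed d atom
  ... | inj₁ a = inj₁ (subst ⊢_ (sub-id A) (slash⇒thm a))
  ... | inj₂ b = inj₂ (subst ⊢_ (sub-id B) (slash⇒thm b))

open AczelSlash

fc-slash : ∀ Σ' σ → Thm Σ' (sub σ fc) → Slash Σ' (sub σ fc)
fc-slash Σ' σ = ◇⇒-slash Σ'

bc-slash : ∀ Σ' σ → Thm Σ' (sub σ bc) → Slash Σ' (sub σ bc)
bc-slash Σ' σ = ⇒□-slash Σ'

noAx-slashClosed : SlashClosed NoAx
noAx-slashClosed σ ()

fcAx-slashClosed : SlashClosed FcAx
fcAx-slashClosed σ fcAx = fc-slash FcAx σ (usub σ (extra fcAx))

bcAx-slashClosed : SlashClosed BcAx
bcAx-slashClosed σ bcAx = bc-slash BcAx σ (usub σ (extra bcAx))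

fbcAx-slashClosed : SlashClosed FbcAx
fbcAx-slashClosed σ fcAx = fc-slash FbcAx σ (usub σ (extra fcAx))
fbcAx-slashClosed σ bcAx = bc-slash FbcAx σ (usub σ (extra bcAx))

mainTheorem16 : (∀ A B → (A ∨' B) ∈Lmin → A ∈Lmin ⊎ B ∈Lmin) × (∀ A B → (A ∨' B) ∈Lfc → A ∈Lfc ⊎ B ∈Lfc) × (∀ A B → (A ∨' B) ∈Lbc → A ∈Lbc ⊎ B ∈Lbc) × (∀ A B → (A ∨' B) ∈Lfbc → A ∈Lfbc ⊎ B ∈Lfbc)
mainTheorem16 =
  disjunctionProperty NoAx  noAx-slashClosed  ,
  disjunctionProperty FcAx  fcAx-slashClosed  ,
  disjunctionProperty BcAx  bcAx-slashClosed  ,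
  disjunctionProperty FbcAx fbcAx-slashClosed
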